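{- Let $N_p$ be the edgeless graph on $p$ vertices. Then for $0\le k\le p$, $$w_k(N_p)=\sum_{i\le k}(-1)^{k-i}\binom{p-i}{p-k}\,i!\,S(p,i),$$ and $$w(N_p,x)=\sum_{i\le p}i!\,S(p,i)\,x^i(1-x)^{p-i}.$$
   Context: $S(p,i)$ is the Stirling number of the second kind (number of partitions of a $p$-set into $i$ nonempty blocks). For a graph $G$ of order $p$ with chromatic polynomial $\chi(G,x)$, the $w_i(G)$ are defined by $\chi(G,x)=\sum_{0\le i\le p}w_i(G)\binom{x+p-i}{p}$, and $w(G,x)=\sum_i w_i(G)x^i$. -}

module Defs where

open import Data.Nat using (ℕ; zero; suc; _∸_) renaming (_+_ to _+ℕ_; _*_ to _*ℕ_)
open import Data.Nat.Combinatorics using (_C_)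
open import Data.Nat using (_!)
open import Data.Integer using (ℤ; +_; -_; _+_; _*_; _-_; _^_; 1ℤ; -1ℤ)
open import Data.Fin using (Fin; zero; suc)
open import Data.Fin.Properties using (_≟_)
open import Data.Vec using (Vec; []; _∷_; lookup)
open import Data.List using (List; []; _∷_; map; concatMap; filter; length; allFin)
open import Data.Bool.ListAction using (and)
open import Data.Bool using (Bool; true; false; not)
open import Relation.Nullary.Decidable using (⌊_⌋)
open import Relation.Binary.PropositionalEquality using (_≡_)

Graph : ℕ → Set
Graph p = Fin p → Fin p → Bool

edgeless : (p : ℕ) → Graph p
edgeless p _ _ = false

colourings : (p x : ℕ) → List (Vec (Fin x) p)
colourings zero    x = [] ∷ []
colourings (suc p) x = concatMap (λ c → map (c ∷_) (colourings p x)) (allFin x)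

proper : {p x : ℕ} → Graph p → Vec (Fin x) p → Bool
proper {p} G c =
  and (concatMap (λ i → map (λ j → not (G i j) Data.Bool.∨ not ⌊ lookup c i ≟ lookup c j ⌋)
                            (allFin p)) (allFin p))

chromatic : {p : ℕ} → Graph p → ℕ → ℕ
chromatic {p} G x = length (filter (λ c → proper G c ≟B true) (colourings p x))
  where
  open import Data.Bool.Properties using () renaming (_≟_ to _≟B_)

S : ℕ → ℕ → ℕ
S zero    zero    = 1
S zero    (suc k) = 0
S (suc n) zero    = 0
S (suc n) (suc k) = suc k *ℕ S n (suc k) +ℕ S n k

∑≤ : ℕ → (ℕ → ℤ) → ℤ
∑≤ zero    f = f 0
∑≤ (suc n) f = ∑≤ n f + f (suc n)

-- w : ℕ → ℤ (only indices 0..p matter) are the w_i(G) of G of order p: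
-- χ(G,x) = ∑_{0≤i≤p} w_i binom(x+p-i, p) as polynomials, i.e. for all x ∈ ℕ.
IsW : {p : ℕ} → Graph p → (ℕ → ℤ) → Set
IsW {p} G w = ∀ (x : ℕ) → + chromatic G x ≡ ∑≤ p (λ i → w i * + ((x +ℕ p ∸ i) C p))

wFormula : ℕ → ℕ → ℤ
wFormula p k = ∑≤ k (λ i → (-1ℤ ^ (k ∸ i)) * + (((p ∸ i) C (p ∸ k)) *ℕ (i !) *ℕ S p i))

wPoly : ℕ → (ℕ → ℤ) → ℤ → ℤ
wPoly p w x = ∑≤ p (λ i → w i * (x ^ i))

-- Every colouring of the edgeless graph is proper, so χ(N_p, x) = x^p = ∑ᵢ i! S(p,i) binomial(x,i),
-- counting maps by their image. Each binomial(x,i) expands in the basis binomial(x+p−k, p) with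
-- coefficients (−1)^(k−i) binomial(p−i, p−k); after reindexing this expansion is an alternating
-- binomial sum, i.e. an iterated finite difference, which Pascal's rule evaluates. Collecting
-- coefficients gives the w_k(N_p). The same alternating sums applied to x^k instead of
-- binomial(x+p−k, p) produce x^i (1−x)^(p−i), which gives w(N_p, x).
module Submission where

open import Defs
open import Data.Nat using (ℕ; zero; suc; _∸_; _≤_; _<_; z≤n; s≤s; _!)
import Data.Nat as ℕ
import Data.Nat.Properties as ℕ
open import Data.Nat.Combinatorics using (_C_; nCk+nC[k+1]≡[n+1]C[k+1]; k>n⇒nCk≡0; nCk≡nC[n∸k]; nCn≡1; nC1≡n)
open import Data.Integer using (ℤ; +_; _+_; _*_; _-_; _^_; 1ℤ; -1ℤ; 0ℤ; _⊖_)
import Data.Integer.Properties as ℤ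
open import Data.Integer.Tactic.RingSolver as ℤ-Solver using ()
open import Data.Nat.Tactic.RingSolver as ℕ-Solver using ()
open import Algebra.Properties.CommutativeSemigroup ℤ.+-commutativeSemigroup using (interchange; x∙yz≈y∙xz)
open import Algebra.Properties.CommutativeSemigroup ℕ.+-commutativeSemigroup
  using () renaming (x∙yz≈y∙xz to m+[n+o]≡n+[m+o])
open import Algebra.Properties.AbelianGroup ℤ.+-0-abelianGroup using (∙-cancelˡ)
open import Data.Product using (_×_; _,_)
open import Data.Sum using (inj₁; inj₂)
open import Data.Fin using (Fin)
open import Data.Vec using (Vec)
open import Data.List using (List; []; _∷_; map; concatMap; length; allFin; _++_)
open import Data.List.Properties using (length-++; length-map; length-tabulate; filter-all)
open import Data.List.Relation.Unary.All using (universal)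
open import Data.Bool.ListAction using (and)
open import Data.Bool using (true)
open import Data.Bool.Properties using () renaming (_≟_ to _≟ᵇ_)
open import Relation.Binary.PropositionalEquality
open ≡-Reasoning

∑-cong : ∀ n {f g : ℕ → ℤ} → (∀ i → i ≤ n → f i ≡ g i) → ∑≤ n f ≡ ∑≤ n g
∑-cong zero    f≡g = f≡g 0 z≤n
∑-cong (suc n) f≡g =
  cong₂ _+_ (∑-cong n (λ i i≤n → f≡g i (ℕ.m≤n⇒m≤1+n i≤n))) (f≡g (suc n) ℕ.≤-refl)

∑-cong′ : ∀ n {f g : ℕ → ℤ} → f ≗ g → ∑≤ n f ≡ ∑≤ n g
∑-cong′ n f≗g = ∑-cong n (λ i _ → f≗g i)

∑-distrib-+ : ∀ n (f g : ℕ → ℤ) → ∑≤ n (λ i → f i + g i) ≡ ∑≤ n f + ∑≤ n g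
∑-distrib-+ zero    f g = refl
∑-distrib-+ (suc n) f g = trans (cong (_+ (f (suc n) + g (suc n))) (∑-distrib-+ n f g))
                                (interchange (∑≤ n f) (∑≤ n g) (f (suc n)) (g (suc n)))

*-distribˡ-∑ : ∀ n (c : ℤ) (f : ℕ → ℤ) → c * ∑≤ n f ≡ ∑≤ n (λ i → c * f i)
*-distribˡ-∑ zero    c f = refl
*-distribˡ-∑ (suc n) c f =
  trans (ℤ.*-distribˡ-+ c (∑≤ n f) (f (suc n))) (cong (_+ c * f (suc n)) (*-distribˡ-∑ n c f))

*-distribʳ-∑ : ∀ n (c : ℤ) (f : ℕ → ℤ) → ∑≤ n f * c ≡ ∑≤ n (λ i → f i * c)
*-distribʳ-∑ zero    c f = refl
*-distribʳ-∑ (suc n) c f =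
  trans (ℤ.*-distribʳ-+ c (∑≤ n f) (f (suc n))) (cong (_+ f (suc n) * c) (*-distribʳ-∑ n c f))

∑-comm : ∀ n m (f : ℕ → ℕ → ℤ) → ∑≤ n (λ i → ∑≤ m (f i)) ≡ ∑≤ m (λ j → ∑≤ n (λ i → f i j))
∑-comm zero    m f = refl
∑-comm (suc n) m f = trans (cong (_+ ∑≤ m (f (suc n))) (∑-comm n m f)) (sym (∑-distrib-+ m _ _))

∑-suc : ∀ n (f : ℕ → ℤ) → ∑≤ (suc n) f ≡ f 0 + ∑≤ n (λ i → f (suc i))
∑-suc zero    f = refl
∑-suc (suc n) f = trans (cong (_+ f (suc (suc n))) (∑-suc n f)) (ℤ.+-assoc (f 0) _ _)

∑-unshift : ∀ n (f : ℕ → ℤ) → f (suc n) ≡ 0ℤ → f 0 + ∑≤ n (λ i → f (suc i)) ≡ ∑≤ n f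
∑-unshift n f last≡0 = begin
  f 0 + ∑≤ n (λ i → f (suc i)) ≡⟨ ∑-suc n f ⟨
  ∑≤ n f + f (suc n)           ≡⟨ cong (λ t → ∑≤ n f + t) last≡0 ⟩
  ∑≤ n f + 0ℤ                  ≡⟨ ℤ.+-identityʳ _ ⟩
  ∑≤ n f                       ∎

∑-vanishing-tail : ∀ {k} n (f : ℕ → ℤ) → k ≤ n → (∀ i → k < i → i ≤ n → f i ≡ 0ℤ) →
                   ∑≤ n f ≡ ∑≤ k f
∑-vanishing-tail zero    f z≤n _ = refl
∑-vanishing-tail {k} (suc n) f k≤1+n tail≡0 with ℕ.m≤n⇒m<n∨m≡n k≤1+n
... | inj₂ refl       = refl
... | inj₁ (s≤s k≤n) = begin
  ∑≤ n f + f (suc n) ≡⟨ cong₂ _+_ (∑-vanishing-tail n f k≤n (λ i k<i i≤n → tail≡0 i k<i (ℕ.m≤n⇒m≤1+n i≤n)))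
                                 (tail≡0 (suc n) (s≤s k≤n) ℕ.≤-refl) ⟩
  ∑≤ k f + 0ℤ        ≡⟨ ℤ.+-identityʳ _ ⟩
  ∑≤ k f             ∎

∑-vanishing-head : ∀ i m (f : ℕ → ℤ) → (∀ k → k < i → f k ≡ 0ℤ) →
                   ∑≤ (i ℕ.+ m) f ≡ ∑≤ m (λ j → f (i ℕ.+ j))
∑-vanishing-head zero    m f head≡0 = refl
∑-vanishing-head (suc i) m f head≡0 = begin
  ∑≤ (suc (i ℕ.+ m)) f                       ≡⟨ ∑-suc (i ℕ.+ m) f ⟩
  f 0 + ∑≤ (i ℕ.+ m) (λ k → f (suc k))       ≡⟨ cong₂ _+_ (head≡0 0 (s≤s z≤n))
                                                  (∑-vanishing-head i m (λ k → f (suc k)) (λ k k<i → head≡0 (suc k) (s≤s k<i))) ⟩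
  0ℤ + ∑≤ m (λ j → f (suc (i ℕ.+ j)))        ≡⟨ ℤ.+-identityˡ _ ⟩
  ∑≤ m (λ j → f (suc i ℕ.+ j))               ∎

C-suc-suc : ∀ n k → suc n C suc k ≡ n C k ℕ.+ n C suc k
C-suc-suc n k = sym (nCk+nC[k+1]≡[n+1]C[k+1] n k)

n*nCk≡[1+k]*nC[1+k]+k*nCk : ∀ n k → n ℕ.* (n C k) ≡ suc k ℕ.* (n C suc k) ℕ.+ k ℕ.* (n C k)
n*nCk≡[1+k]*nC[1+k]+k*nCk zero    zero    = refl
n*nCk≡[1+k]*nC[1+k]+k*nCk zero    (suc k) = sym (cong₂ ℕ._+_ (ℕ.*-zeroʳ (suc (suc k))) (ℕ.*-zeroʳ (suc k)))
n*nCk≡[1+k]*nC[1+k]+k*nCk (suc n) zero    =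
  trans (ℕ.*-identityʳ (suc n)) (sym (trans (ℕ.+-identityʳ _) (trans (ℕ.+-identityʳ _) (nC1≡n (suc n)))))
n*nCk≡[1+k]*nC[1+k]+k*nCk (suc n) (suc k)
  rewrite C-suc-suc n k | C-suc-suc n (suc k) = begin
    suc n ℕ.* (a ℕ.+ b)                                   ≡⟨ expand n a b ⟩
    a ℕ.+ b ℕ.+ n ℕ.* a ℕ.+ n ℕ.* b                       ≡⟨ cong₂ (λ s t → a ℕ.+ b ℕ.+ s ℕ.+ t)
                                                               (n*nCk≡[1+k]*nC[1+k]+k*nCk n k)
                                                               (n*nCk≡[1+k]*nC[1+k]+k*nCk n (suc k)) ⟩
    a ℕ.+ b ℕ.+ (suc k ℕ.* b ℕ.+ k ℕ.* a)
        ℕ.+ (suc (suc k) ℕ.* c ℕ.+ suc k ℕ.* b)           ≡⟨ collect k a b c ⟩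
    suc (suc k) ℕ.* (b ℕ.+ c) ℕ.+ suc k ℕ.* (a ℕ.+ b)     ∎
  where
  a = n C k
  b = n C suc k
  c = n C suc (suc k)
  expand : ∀ n a b → suc n ℕ.* (a ℕ.+ b) ≡ a ℕ.+ b ℕ.+ n ℕ.* a ℕ.+ n ℕ.* b
  expand = ℕ-Solver.solve-∀
  collect : ∀ k a b c → a ℕ.+ b ℕ.+ (suc k ℕ.* b ℕ.+ k ℕ.* a) ℕ.+ (suc (suc k) ℕ.* c ℕ.+ suc k ℕ.* b)
                        ≡ suc (suc k) ℕ.* (b ℕ.+ c) ℕ.+ suc k ℕ.* (a ℕ.+ b)
  collect = ℕ-Solver.solve-∀

S-vanishes : ∀ {n k} → n < k → S n k ≡ 0
S-vanishes {zero}  {suc k} _ = refl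
S-vanishes {suc n} {suc k} (s≤s n<k)
  rewrite S-vanishes (ℕ.m≤n⇒m≤1+n n<k) | S-vanishes n<k =
  trans (ℕ.+-identityʳ _) (ℕ.*-zeroʳ (suc k))

surjections : ℕ → ℕ → ℕ
surjections p i = i ! ℕ.* S p i

surjections-suc : ∀ p i → surjections (suc p) (suc i) ≡ suc i ℕ.* (surjections p (suc i) ℕ.+ surjections p i)
surjections-suc p i = recurrence i (i !) (S p (suc i)) (S p i)
  where
  recurrence : ∀ i f a b → (suc i ℕ.* f) ℕ.* (suc i ℕ.* a ℕ.+ b) ≡ suc i ℕ.* ((suc i ℕ.* f) ℕ.* a ℕ.+ f ℕ.* b)
  recurrence = ℕ-Solver.solve-∀

pow≡∑surjections*C : ∀ p x → + (x ℕ.^ p) ≡ ∑≤ p (λ i → + (surjections p i ℕ.* (x C i)))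
pow≡∑surjections*C zero    x = refl
pow≡∑surjections*C (suc p) x = sym (begin
  ∑≤ (suc p) (λ i → + (surjections (suc p) i ℕ.* (x C i)))       ≡⟨ ∑-suc p _ ⟩
  0ℤ + ∑≤ p (λ i → + (surjections (suc p) (suc i) ℕ.* (x C suc i))) ≡⟨ ℤ.+-identityˡ _ ⟩
  ∑≤ p (λ i → + (surjections (suc p) (suc i) ℕ.* (x C suc i)))   ≡⟨ ∑-cong′ p (λ i → cong +_ (split i)) ⟩
  ∑≤ p (λ i → + (u (suc i) ℕ.+ v i))                            ≡⟨ ∑-cong′ p (λ i → ℤ.pos-+ (u (suc i)) (v i)) ⟩
  ∑≤ p (λ i → + u (suc i) + + v i)                              ≡⟨ ∑-distrib-+ p _ _ ⟩
  ∑≤ p (λ i → + u (suc i)) + ∑≤ p (λ i → + v i)                 ≡⟨ cong (_+ ∑≤ p (λ i → + v i)) (ℤ.+-identityˡ (∑≤ p (λ i → + u (suc i)))) ⟨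
  (+ u 0 + ∑≤ p (λ i → + u (suc i))) + ∑≤ p (λ i → + v i)       ≡⟨ cong (_+ ∑≤ p (λ i → + v i)) (∑-unshift p (λ i → + u i) u-last) ⟩
  ∑≤ p (λ i → + u i) + ∑≤ p (λ i → + v i)                       ≡⟨ ∑-distrib-+ p _ _ ⟨
  ∑≤ p (λ i → + u i + + v i)                                    ≡⟨ ∑-cong′ p (λ i → trans (sym (ℤ.pos-+ (u i) (v i))) (cong +_ (merge i))) ⟩
  ∑≤ p (λ i → + (x ℕ.* (surjections p i ℕ.* (x C i))))          ≡⟨ ∑-cong′ p (λ i → ℤ.pos-* x _) ⟩
  ∑≤ p (λ i → + x * + (surjections p i ℕ.* (x C i)))            ≡⟨ *-distribˡ-∑ p (+ x) _ ⟨
  + x * ∑≤ p (λ i → + (surjections p i ℕ.* (x C i)))            ≡⟨ cong (+ x *_) (pow≡∑surjections*C p x) ⟨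
  + x * + (x ℕ.^ p)                                             ≡⟨ ℤ.pos-* x _ ⟨
  + (x ℕ.^ suc p)                                               ∎)
  where
  u v : ℕ → ℕ
  u i = i ℕ.* (x C i) ℕ.* surjections p i
  v i = suc i ℕ.* (x C suc i) ℕ.* surjections p i

  split : ∀ i → surjections (suc p) (suc i) ℕ.* (x C suc i) ≡ u (suc i) ℕ.+ v i
  split i rewrite surjections-suc p i = distribute (suc i) (surjections p (suc i)) (surjections p i) (x C suc i)
    where
    distribute : ∀ j a b c → j ℕ.* (a ℕ.+ b) ℕ.* c ≡ j ℕ.* c ℕ.* a ℕ.+ j ℕ.* c ℕ.* b
    distribute = ℕ-Solver.solve-∀

  u-last : + u (suc p) ≡ 0ℤ
  u-last rewrite S-vanishes (ℕ.n<1+n p) | ℕ.*-zeroʳ (suc p !) = cong +_ (ℕ.*-zeroʳ (suc p ℕ.* (x C suc p)))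

  merge : ∀ i → u i ℕ.+ v i ≡ x ℕ.* (surjections p i ℕ.* (x C i))
  merge i = begin
    u i ℕ.+ v i                                                ≡⟨ ℕ.*-distribʳ-+ s (i ℕ.* (x C i)) _ ⟨
    (i ℕ.* (x C i) ℕ.+ suc i ℕ.* (x C suc i)) ℕ.* s            ≡⟨ cong (ℕ._* s) (ℕ.+-comm (i ℕ.* (x C i)) _) ⟩
    (suc i ℕ.* (x C suc i) ℕ.+ i ℕ.* (x C i)) ℕ.* s            ≡⟨ cong (ℕ._* s) (n*nCk≡[1+k]*nC[1+k]+k*nCk x i) ⟨
    x ℕ.* (x C i) ℕ.* s                                        ≡⟨ ℕ.*-assoc x _ s ⟩
    x ℕ.* ((x C i) ℕ.* s)                                      ≡⟨ cong (x ℕ.*_) (ℕ.*-comm (x C i) s) ⟩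
    x ℕ.* (s ℕ.* (x C i))                                      ∎
    where s = surjections p i

-- ((1 − E)ᵐ f)(0) for the shift E f = f ∘ suc, i.e. the m-th forward difference of f at 0 up to the sign (−1)ᵐ
altBinomialSum : ℕ → (ℕ → ℤ) → ℤ
altBinomialSum m f = ∑≤ m (λ j → -1ℤ ^ j * + (m C j) * f j)

altBinomialSum-cong : ∀ m {f g : ℕ → ℤ} → (∀ j → j ≤ m → f j ≡ g j) → altBinomialSum m f ≡ altBinomialSum m g
altBinomialSum-cong m f≡g = ∑-cong m (λ j j≤m → cong (-1ℤ ^ j * + (m C j) *_) (f≡g j j≤m))

altBinomialSum-*ˡ : ∀ m c (f : ℕ → ℤ) → altBinomialSum m (λ j → c * f j) ≡ c * altBinomialSum m f
altBinomialSum-*ˡ m c f = begin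
  ∑≤ m (λ j → -1ℤ ^ j * + (m C j) * (c * f j))   ≡⟨ ∑-cong′ m (λ j → reorder (-1ℤ ^ j * + (m C j)) c (f j)) ⟩
  ∑≤ m (λ j → c * (-1ℤ ^ j * + (m C j) * f j))   ≡⟨ *-distribˡ-∑ m c _ ⟨
  c * altBinomialSum m f                         ∎
  where
  reorder : ∀ a c b → a * (c * b) ≡ c * (a * b)
  reorder = ℤ-Solver.solve-∀

altBinomialSum-*ʳ : ∀ m c (f : ℕ → ℤ) → altBinomialSum m (λ j → f j * c) ≡ altBinomialSum m f * c
altBinomialSum-*ʳ m c f = begin
  ∑≤ m (λ j → -1ℤ ^ j * + (m C j) * (f j * c))   ≡⟨ ∑-cong′ m (λ j → ℤ.*-assoc (-1ℤ ^ j * + (m C j)) (f j) c) ⟨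
  ∑≤ m (λ j → -1ℤ ^ j * + (m C j) * f j * c)     ≡⟨ *-distribʳ-∑ m c _ ⟨
  altBinomialSum m f * c                         ∎

-- Pascal's rule splits the row m+1 into two copies of the row m, one of them shifted by one.
altBinomialSum-suc : ∀ m (f : ℕ → ℤ) → altBinomialSum (suc m) f ≡ altBinomialSum m (λ j → f j - f (suc j))
altBinomialSum-suc m f = begin
  altBinomialSum (suc m) f                          ≡⟨ ∑-suc m _ ⟩
  Z 0 + ∑≤ m (λ j → -1ℤ ^ suc j * + (suc m C suc j) * f (suc j))
                                                    ≡⟨ cong (λ t → Z 0 + t) (∑-cong′ m pascal) ⟩
  Z 0 + ∑≤ m (λ j → X j + Z (suc j))                ≡⟨ cong (λ t → Z 0 + t) (∑-distrib-+ m X (λ j → Z (suc j))) ⟩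
  Z 0 + (∑≤ m X + ∑≤ m (λ j → Z (suc j)))           ≡⟨ x∙yz≈y∙xz (Z 0) (∑≤ m X) _ ⟩
  ∑≤ m X + (Z 0 + ∑≤ m (λ j → Z (suc j)))           ≡⟨ cong (λ t → ∑≤ m X + t) (∑-unshift m Z Z-last) ⟩
  ∑≤ m X + ∑≤ m Z                                   ≡⟨ ℤ.+-comm (∑≤ m X) _ ⟩
  ∑≤ m Z + ∑≤ m X                                   ≡⟨ ∑-distrib-+ m Z X ⟨
  ∑≤ m (λ j → Z j + X j)                            ≡⟨ ∑-cong′ m Z+X≡ ⟩
  altBinomialSum m (λ j → f j - f (suc j))          ∎
  where
  Z X : ℕ → ℤ
  Z j = -1ℤ ^ j * + (m C j) * f j
  X j = -1ℤ ^ suc j * + (m C j) * f (suc j)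

  pascal : ∀ j → -1ℤ ^ suc j * + (suc m C suc j) * f (suc j) ≡ X j + Z (suc j)
  pascal j = begin
    -1ℤ ^ suc j * + (suc m C suc j) * f (suc j)                ≡⟨ cong (λ c → -1ℤ ^ suc j * c * f (suc j))
                                                                    (trans (cong +_ (C-suc-suc m j)) (ℤ.pos-+ (m C j) _)) ⟩
    -1ℤ ^ suc j * (+ (m C j) + + (m C suc j)) * f (suc j)      ≡⟨ distribute (-1ℤ ^ suc j) (+ (m C j)) _ (f (suc j)) ⟩
    X j + Z (suc j)                                            ∎
    where
    distribute : ∀ s a b c → s * (a + b) * c ≡ s * a * c + s * b * c
    distribute = ℤ-Solver.solve-∀

  Z-last : Z (suc m) ≡ 0ℤ
  Z-last rewrite k>n⇒nCk≡0 (ℕ.n<1+n m) = cong (_* f (suc m)) (ℤ.*-zeroʳ (-1ℤ ^ suc m))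

  Z+X≡ : ∀ j → Z j + X j ≡ -1ℤ ^ j * + (m C j) * (f j - f (suc j))
  Z+X≡ j = factor (-1ℤ ^ j) (+ (m C j)) (f j) (f (suc j))
    where
    factor : ∀ s c a b → s * c * a + (-1ℤ * s) * c * b ≡ s * c * (a - b)
    factor = ℤ-Solver.solve-∀

altBinomialSum-pow : ∀ m (x : ℤ) → altBinomialSum m (x ^_) ≡ (1ℤ - x) ^ m
altBinomialSum-pow zero    x = refl
altBinomialSum-pow (suc m) x = begin
  altBinomialSum (suc m) (x ^_)                     ≡⟨ altBinomialSum-suc m (x ^_) ⟩
  altBinomialSum m (λ j → x ^ j - x * x ^ j)        ≡⟨ altBinomialSum-cong m (λ j _ → factor (x ^ j) x) ⟩
  altBinomialSum m (λ j → x ^ j * (1ℤ - x))         ≡⟨ altBinomialSum-*ʳ m (1ℤ - x) (x ^_) ⟩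
  altBinomialSum m (x ^_) * (1ℤ - x)                ≡⟨ cong (_* (1ℤ - x)) (altBinomialSum-pow m x) ⟩
  (1ℤ - x) ^ m * (1ℤ - x)                           ≡⟨ ℤ.*-comm ((1ℤ - x) ^ m) _ ⟩
  (1ℤ - x) ^ suc m                                  ∎
  where
  factor : ∀ y x → y - x * y ≡ y * (1ℤ - x)
  factor = ℤ-Solver.solve-∀

altBinomialSum-choose : ∀ m x q → altBinomialSum m (λ j → + ((x ℕ.+ m ∸ j) C (q ℕ.+ m))) ≡ + (x C q)
altBinomialSum-choose zero    x q rewrite ℕ.+-identityʳ x | ℕ.+-identityʳ q = ℤ.*-identityˡ (+ (x C q))
altBinomialSum-choose (suc m) x q = begin
  altBinomialSum (suc m) f                                     ≡⟨ altBinomialSum-suc m f ⟩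
  altBinomialSum m (λ j → f j - f (suc j))                     ≡⟨ altBinomialSum-cong m difference ⟩
  altBinomialSum m (λ j → + ((x ℕ.+ m ∸ j) C (q ℕ.+ m)))       ≡⟨ altBinomialSum-choose m x q ⟩
  + (x C q)                                                    ∎
  where
  f : ℕ → ℤ
  f j = + ((x ℕ.+ suc m ∸ j) C (q ℕ.+ suc m))

  difference : ∀ j → j ≤ m → f j - f (suc j) ≡ + ((x ℕ.+ m ∸ j) C (q ℕ.+ m))
  difference j j≤m
    rewrite ℕ.+-suc x m | ℕ.+-suc q m | ℕ.+-∸-assoc 1 (ℕ.≤-trans j≤m (ℕ.m≤n+m m x))
          | C-suc-suc (x ℕ.+ m ∸ j) (q ℕ.+ m) = begin
    + (a ℕ.+ b) - + b     ≡⟨ ℤ.[+m]-[+n]≡m⊖n (a ℕ.+ b) b ⟩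
    (a ℕ.+ b) ⊖ b         ≡⟨ ℤ.⊖-≥ (ℕ.m≤n+m b a) ⟩
    + (a ℕ.+ b ∸ b)       ≡⟨ cong +_ (ℕ.m+n∸n≡m a b) ⟩
    + a                   ∎
    where
    a = (x ℕ.+ m ∸ j) C (q ℕ.+ m)
    b = (x ℕ.+ m ∸ j) C suc (q ℕ.+ m)

-- the coefficients of binomial(x, i) in the basis binomial(x + p − k, p), k ≤ p
kernel : ℕ → ℕ → ℕ → ℤ
kernel p i k = -1ℤ ^ (k ∸ i) * + ((p ∸ i) C (p ∸ k))

kernel-vanishes : ∀ {p i k} → k < i → i ≤ p → kernel p i k ≡ 0ℤ
kernel-vanishes {p} {i} {k} k<i i≤p rewrite k>n⇒nCk≡0 (ℕ.∸-monoʳ-< k<i i≤p) = ℤ.*-zeroʳ (-1ℤ ^ (k ∸ i))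

∑-kernel : ∀ i m (g : ℕ → ℤ) → ∑≤ (i ℕ.+ m) (λ k → kernel (i ℕ.+ m) i k * g k) ≡ altBinomialSum m (λ j → g (i ℕ.+ j))
∑-kernel i m g = trans (∑-vanishing-head i m _ head≡0) (∑-cong m reindex)
  where
  head≡0 : ∀ k → k < i → kernel (i ℕ.+ m) i k * g k ≡ 0ℤ
  head≡0 k k<i = trans (cong (_* g k) (kernel-vanishes k<i (ℕ.m≤m+n i m))) (ℤ.*-zeroˡ (g k))

  reindex : ∀ j → j ≤ m → kernel (i ℕ.+ m) i (i ℕ.+ j) * g (i ℕ.+ j) ≡ -1ℤ ^ j * + (m C j) * g (i ℕ.+ j)
  reindex j j≤m rewrite ℕ.m+n∸m≡n i j | ℕ.m+n∸m≡n i m | ℕ.[m+n]∸[m+o]≡n∸o i m j =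
    cong (λ c → -1ℤ ^ j * + c * g (i ℕ.+ j)) (sym (nCk≡nC[n∸k] j≤m))

∑-kernel-choose : ∀ {p i} x → i ≤ p → ∑≤ p (λ k → kernel p i k * + ((x ℕ.+ p ∸ k) C p)) ≡ + (x C i)
∑-kernel-choose {i = i} x i≤p with ℕ.m≤n⇒∃[o]m+o≡n i≤p
... | m , refl = begin
  ∑≤ (i ℕ.+ m) (λ k → kernel (i ℕ.+ m) i k * + ((x ℕ.+ (i ℕ.+ m) ∸ k) C (i ℕ.+ m)))
    ≡⟨ ∑-kernel i m _ ⟩
  altBinomialSum m (λ j → + ((x ℕ.+ (i ℕ.+ m) ∸ (i ℕ.+ j)) C (i ℕ.+ m)))
    ≡⟨ altBinomialSum-cong m (λ j _ → cong (λ n → + (n C (i ℕ.+ m))) (cancel-i j)) ⟩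
  altBinomialSum m (λ j → + ((x ℕ.+ m ∸ j) C (i ℕ.+ m)))
    ≡⟨ altBinomialSum-choose m x i ⟩
  + (x C i) ∎
  where
  cancel-i : ∀ j → x ℕ.+ (i ℕ.+ m) ∸ (i ℕ.+ j) ≡ x ℕ.+ m ∸ j
  cancel-i j = trans (cong (_∸ (i ℕ.+ j)) (m+[n+o]≡n+[m+o] x i m)) (ℕ.[m+n]∸[m+o]≡n∸o i (x ℕ.+ m) j)

∑-kernel-pow : ∀ {p i} (x : ℤ) → i ≤ p → ∑≤ p (λ k → kernel p i k * x ^ k) ≡ x ^ i * (1ℤ - x) ^ (p ∸ i)
∑-kernel-pow {i = i} x i≤p with ℕ.m≤n⇒∃[o]m+o≡n i≤p
... | m , refl = begin
  ∑≤ (i ℕ.+ m) (λ k → kernel (i ℕ.+ m) i k * x ^ k)    ≡⟨ ∑-kernel i m (x ^_) ⟩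
  altBinomialSum m (λ j → x ^ (i ℕ.+ j))              ≡⟨ altBinomialSum-cong m (λ j _ → ℤ.^-distribˡ-+-* x i j) ⟩
  altBinomialSum m (λ j → x ^ i * x ^ j)              ≡⟨ altBinomialSum-*ˡ m (x ^ i) (x ^_) ⟩
  x ^ i * altBinomialSum m (x ^_)                     ≡⟨ cong (x ^ i *_) (altBinomialSum-pow m x) ⟩
  x ^ i * (1ℤ - x) ^ m                                ≡⟨ cong (λ n → x ^ i * (1ℤ - x) ^ n) (ℕ.m+n∸m≡n i m) ⟨
  x ^ i * (1ℤ - x) ^ (i ℕ.+ m ∸ i)                    ∎

wFormula≡∑kernel : ∀ {p k} → k ≤ p → wFormula p k ≡ ∑≤ p (λ i → kernel p i k * + surjections p i)
wFormula≡∑kernel {p} {k} k≤p = begin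
  wFormula p k                                       ≡⟨ ∑-cong′ k term ⟩
  ∑≤ k (λ i → kernel p i k * + surjections p i)      ≡⟨ ∑-vanishing-tail p _ k≤p tail≡0 ⟨
  ∑≤ p (λ i → kernel p i k * + surjections p i)      ∎
  where
  term : ∀ i → -1ℤ ^ (k ∸ i) * + (((p ∸ i) C (p ∸ k)) ℕ.* (i !) ℕ.* S p i) ≡ kernel p i k * + surjections p i
  term i = begin
    -1ℤ ^ (k ∸ i) * + (((p ∸ i) C (p ∸ k)) ℕ.* (i !) ℕ.* S p i)      ≡⟨ cong (λ n → -1ℤ ^ (k ∸ i) * + n) (ℕ.*-assoc ((p ∸ i) C (p ∸ k)) _ _) ⟩
    -1ℤ ^ (k ∸ i) * + (((p ∸ i) C (p ∸ k)) ℕ.* surjections p i)  ≡⟨ cong (-1ℤ ^ (k ∸ i) *_) (ℤ.pos-* ((p ∸ i) C (p ∸ k)) _) ⟩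
    -1ℤ ^ (k ∸ i) * (+ ((p ∸ i) C (p ∸ k)) * + surjections p i) ≡⟨ ℤ.*-assoc (-1ℤ ^ (k ∸ i)) _ _ ⟨
    kernel p i k * + surjections p i                             ∎

  tail≡0 : ∀ i → k < i → i ≤ p → kernel p i k * + surjections p i ≡ 0ℤ
  tail≡0 i k<i i≤p = trans (cong (_* + surjections p i) (kernel-vanishes k<i i≤p)) (ℤ.*-zeroˡ (+ surjections p i))

∑-wFormula : ∀ p (g : ℕ → ℤ) →
  ∑≤ p (λ k → wFormula p k * g k) ≡ ∑≤ p (λ i → + surjections p i * ∑≤ p (λ k → kernel p i k * g k))
∑-wFormula p g = begin
  ∑≤ p (λ k → wFormula p k * g k)                                  ≡⟨ ∑-cong p (λ k k≤p → cong (_* g k) (wFormula≡∑kernel k≤p)) ⟩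
  ∑≤ p (λ k → ∑≤ p (λ i → kernel p i k * s i) * g k)               ≡⟨ ∑-cong′ p (λ k → *-distribʳ-∑ p (g k) _) ⟩
  ∑≤ p (λ k → ∑≤ p (λ i → kernel p i k * s i * g k))               ≡⟨ ∑-comm p p _ ⟩
  ∑≤ p (λ i → ∑≤ p (λ k → kernel p i k * s i * g k))               ≡⟨ ∑-cong′ p (λ i → ∑-cong′ p (λ k → reorder (kernel p i k) (s i) (g k))) ⟩
  ∑≤ p (λ i → ∑≤ p (λ k → s i * (kernel p i k * g k)))             ≡⟨ ∑-cong′ p (λ i → *-distribˡ-∑ p (s i) _) ⟨
  ∑≤ p (λ i → s i * ∑≤ p (λ k → kernel p i k * g k))               ∎
  where
  s : ℕ → ℤ
  s i = + surjections p i
  reorder : ∀ a b c → a * b * c ≡ b * (a * c)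
  reorder = ℤ-Solver.solve-∀

and-map-true-++ : ∀ {A : Set} (xs : List A) bs → and (map (λ _ → true) xs ++ bs) ≡ and bs
and-map-true-++ []       bs = refl
and-map-true-++ (_ ∷ xs) bs = and-map-true-++ xs bs

proper-edgeless : ∀ {p x} (c : Vec (Fin x) p) → proper (edgeless p) c ≡ true
proper-edgeless {p} c = all-rows (allFin p)
  where
  all-rows : ∀ is → and (concatMap (λ _ → map (λ _ → true) (allFin p)) is) ≡ true
  all-rows []       = refl
  all-rows (_ ∷ is) = trans (and-map-true-++ (allFin p) _) (all-rows is)

length-concatMap-const : ∀ {A B : Set} {n} (f : A → List B) → (∀ a → length (f a) ≡ n) →
                         ∀ xs → length (concatMap f xs) ≡ length xs ℕ.* n
length-concatMap-const f len[f] []       = refl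
length-concatMap-const f len[f] (a ∷ xs) =
  trans (length-++ (f a)) (cong₂ ℕ._+_ (len[f] a) (length-concatMap-const f len[f] xs))

length-colourings : ∀ p x → length (colourings p x) ≡ x ℕ.^ p
length-colourings zero    x = refl
length-colourings (suc p) x = begin
  length (colourings (suc p) x)                  ≡⟨ length-concatMap-const _ length-row (allFin x) ⟩
  length (allFin x) ℕ.* x ℕ.^ p                  ≡⟨ cong (ℕ._* x ℕ.^ p) (length-tabulate {n = x} (λ c → c)) ⟩
  x ℕ.* x ℕ.^ p                                  ∎
  where
  length-row : ∀ c → length (map (c Data.Vec.∷_) (colourings p x)) ≡ x ℕ.^ p
  length-row c = trans (length-map _ (colourings p x)) (length-colourings p x)

chromatic-edgeless : ∀ p x → chromatic (edgeless p) x ≡ x ℕ.^ p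
chromatic-edgeless p x = begin
  chromatic (edgeless p) x                                   ≡⟨ cong length (filter-all (λ c → proper (edgeless p) c ≟ᵇ true) (universal proper-edgeless (colourings p x))) ⟩
  length (colourings p x)                                    ≡⟨ length-colourings p x ⟩
  x ℕ.^ p                                                    ∎

unitriangular-injective : ∀ p (M : ℕ → ℕ → ℤ) {u v : ℕ → ℤ} →
  (∀ {k i} → k < i → i ≤ p → M k i ≡ 0ℤ) → (∀ k → M k k ≡ 1ℤ) →
  (∀ k → k ≤ p → ∑≤ p (λ i → u i * M k i) ≡ ∑≤ p (λ i → v i * M k i)) →
  ∀ k → k ≤ p → u k ≡ v k
unitriangular-injective p M {u} {v} upper diag ∑u≡∑v k k≤p = agree k k≤p k ℕ.≤-refl
  where
  truncate : ∀ (f : ℕ → ℤ) k → k ≤ p → ∑≤ p (λ i → f i * M k i) ≡ ∑≤ k (λ i → f i * M k i)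
  truncate f k k≤p =
    ∑-vanishing-tail p _ k≤p (λ i k<i i≤p → trans (cong (f i *_) (upper k<i i≤p)) (ℤ.*-zeroʳ (f i)))

  ∑u≡∑v-below : ∀ k → k ≤ p → ∑≤ k (λ i → u i * M k i) ≡ ∑≤ k (λ i → v i * M k i)
  ∑u≡∑v-below k k≤p = trans (sym (truncate u k k≤p)) (trans (∑u≡∑v k k≤p) (truncate v k k≤p))

  cancel-diag : ∀ k → u k * M k k ≡ v k * M k k → u k ≡ v k
  cancel-diag k eq = begin
    u k          ≡⟨ ℤ.*-identityʳ (u k) ⟨
    u k * 1ℤ     ≡⟨ cong (u k *_) (diag k) ⟨
    u k * M k k  ≡⟨ eq ⟩
    v k * M k k  ≡⟨ cong (v k *_) (diag k) ⟩
    v k * 1ℤ     ≡⟨ ℤ.*-identityʳ (v k) ⟩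
    v k          ∎

  agree : ∀ k → k ≤ p → ∀ i → i ≤ k → u i ≡ v i
  agree zero    _    _ z≤n = cancel-diag 0 (∑u≡∑v-below 0 z≤n)
  agree (suc k) k<p i i≤1+k with ℕ.m≤n⇒m<n∨m≡n i≤1+k
  ... | inj₁ (s≤s i≤k) = agree k (ℕ.<⇒≤ k<p) i i≤k
  ... | inj₂ refl      = cancel-diag (suc k) (∙-cancelˡ (∑≤ k (λ j → v j * M (suc k) j)) _ _ (begin
    ∑≤ k (λ j → v j * M (suc k) j) + u (suc k) * M (suc k) (suc k)
      ≡⟨ cong (_+ u (suc k) * M (suc k) (suc k)) (∑-cong k below) ⟨
    ∑≤ k (λ j → u j * M (suc k) j) + u (suc k) * M (suc k) (suc k)
      ≡⟨ ∑u≡∑v-below (suc k) k<p ⟩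
    ∑≤ k (λ j → v j * M (suc k) j) + v (suc k) * M (suc k) (suc k) ∎))
    where
    below : ∀ j → j ≤ k → u j * M (suc k) j ≡ v j * M (suc k) j
    below j j≤k = cong (_* M (suc k) j) (agree k (ℕ.<⇒≤ k<p) j j≤k)

-- Evaluating at x = k turns the basis binomial(x + p − i, p) into a unitriangular matrix.
IsW-unique : ∀ {p} (G : Graph p) {w w′ : ℕ → ℤ} → IsW G w → IsW G w′ → ∀ k → k ≤ p → w k ≡ w′ k
IsW-unique {p} G isW isW′ =
  unitriangular-injective p (λ k i → + ((k ℕ.+ p ∸ i) C p)) upper diag (λ k _ → trans (sym (isW k)) (isW′ k))
  where
  upper : ∀ {k i} → k < i → i ≤ p → + ((k ℕ.+ p ∸ i) C p) ≡ 0ℤ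
  upper {k} {i} k<i i≤p = cong +_ (k>n⇒nCk≡0 (subst (k ℕ.+ p ∸ i <_) (ℕ.m+n∸m≡n k p)
                            (ℕ.∸-monoʳ-< k<i (ℕ.≤-trans i≤p (ℕ.m≤n+m p k)))))

  diag : ∀ k → + ((k ℕ.+ p ∸ k) C p) ≡ 1ℤ
  diag k = cong +_ (trans (cong (_C p) (ℕ.m+n∸m≡n k p)) (nCn≡1 p))

wFormula-isW : ∀ p → IsW (edgeless p) (wFormula p)
wFormula-isW p x = begin
  + chromatic (edgeless p) x                                    ≡⟨ cong +_ (chromatic-edgeless p x) ⟩
  + (x ℕ.^ p)                                                   ≡⟨ pow≡∑surjections*C p x ⟩
  ∑≤ p (λ i → + (surjections p i ℕ.* (x C i)))                  ≡⟨ ∑-cong p inverse ⟩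
  ∑≤ p (λ i → + surjections p i * ∑≤ p (λ k → kernel p i k * B k)) ≡⟨ ∑-wFormula p B ⟨
  ∑≤ p (λ k → wFormula p k * B k)                               ∎
  where
  B : ℕ → ℤ
  B k = + ((x ℕ.+ p ∸ k) C p)

  inverse : ∀ i → i ≤ p → + (surjections p i ℕ.* (x C i)) ≡ + surjections p i * ∑≤ p (λ k → kernel p i k * B k)
  inverse i i≤p = trans (ℤ.pos-* (surjections p i) _) (cong (+ surjections p i *_) (sym (∑-kernel-choose x i≤p)))

wPoly-wFormula : ∀ p x → wPoly p (wFormula p) x ≡ ∑≤ p (λ i → + surjections p i * x ^ i * (1ℤ - x) ^ (p ∸ i))
wPoly-wFormula p x = begin
  ∑≤ p (λ k → wFormula p k * x ^ k)                                          ≡⟨ ∑-wFormula p (x ^_) ⟩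
  ∑≤ p (λ i → + surjections p i * ∑≤ p (λ k → kernel p i k * x ^ k))         ≡⟨ ∑-cong p (λ i i≤p → cong (+ surjections p i *_) (∑-kernel-pow x i≤p)) ⟩
  ∑≤ p (λ i → + surjections p i * (x ^ i * (1ℤ - x) ^ (p ∸ i)))              ≡⟨ ∑-cong′ p (λ i → ℤ.*-assoc (+ surjections p i) _ _) ⟨
  ∑≤ p (λ i → + surjections p i * x ^ i * (1ℤ - x) ^ (p ∸ i))                ∎

mainTheorem9 : (p : ℕ) →
    IsW (edgeless p) (wFormula p)
    × (∀ (w : ℕ → ℤ) → IsW (edgeless p) w → ∀ (k : ℕ) → k ≤ p → w k ≡ wFormula p k)
    × (∀ (w : ℕ → ℤ) → IsW (edgeless p) w → ∀ (x : ℤ) →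
        wPoly p w x ≡ ∑≤ p (λ i → + ((i !) Data.Nat.* S p i) * (x ^ i) * ((1ℤ - x) ^ (p ∸ i))))
mainTheorem9 p = wFormula-isW p , unique , λ w isW x →
  trans (∑-cong p (λ k k≤p → cong (_* x ^ k) (unique w isW k k≤p))) (wPoly-wFormula p x)
  where
  unique : ∀ w → IsW (edgeless p) w → ∀ k → k ≤ p → w k ≡ wFormula p k
  unique w isW = IsW-unique (edgeless p) isW (wFormula-isW p)
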